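{- Let $D=(F,T)\in\mathcal D_k$ and let $H,H'$ be graphs such that for all graphs $G\supseteq F$ with $V(G)=V(F)$ and $(G,T)\in\mathcal D_k$ we have $\mathrm{pp\text{ - }hom}((G,T),H)=\mathrm{pp\text{ - }hom}((G,T),H')$. Then $\mathrm{pi\text{ - }hom}(D,H)=\mathrm{pi\text{ - }hom}(D,H')$.
   Context: Graphs are finite, undirected, vertex-coloured triples $(V(G),E(G),\gamma^G)$. $G\supseteq F$ means $F$ is a subgraph of $G$ (vertex and edge inclusion, colours agree). A homomorphism preserves edges and colours. A tree is a finite poset $(V(T),\preceq)$ with a unique minimal element in which each $\{u:u\preceq t\}$ is a chain; height = maximum number of elements in a chain. An elimination tree of a graph $F$ is a tree on $V(F)$ with $u\preceq v$ or $v\preceq u$ for every edge $uv$. $\mathcal D_k$ is the class of pairs $(F,T)$ with $F$ a graph and $T$ an elimination tree of $F$ of height at most $k$. A homomorphism $h:(F,T)\to H$ (homomorphism $F\to H$) is past-injective if $h(u)\ne h(v)$ whenever $u\prec^T v$; it is past-preserving if moreover for all $u\preceq^T v$: $uv\in E(F)\iff h(u)h(v)\in E(H)$. $\mathrm{pi\text{ - }hom}$ and $\mathrm{pp\text{ - }hom}$ count past-injective and past-preserving homomorphisms. -}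

module Defs where

open import Data.Nat using (ℕ; zero; suc; _≤_; _≡ᵇ_)
open import Data.Bool using (Bool; true; false; not; _∧_; _∨_; T; if_then_else_)
open import Data.Fin using (Fin; zero; suc)
open import Data.Fin.Properties using (_≟_)
open import Data.List using (List; []; _∷_; length; map; concatMap; allFin; filterᵇ; foldr)
open import Data.List.Relation.Unary.Unique.Propositional using (Unique)
open import Data.List.Membership.Propositional using (_∈_)
open import Data.Product using (Σ; _×_)
open import Data.Sum using (_⊎_)
open import Relation.Nullary.Decidable using (⌊_⌋)
open import Relation.Binary.PropositionalEquality using (_≡_)

allFinᵇ : {n : ℕ} → (Fin n → Bool) → Bool
allFinᵇ {n} p = foldr (λ i b → p i ∧ b) true (allFin n)

_⇔ᵇ_ : Bool → Bool → Bool
a ⇔ᵇ b = if a then b else not b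

_==ᶠ_ : {n : ℕ} → Fin n → Fin n → Bool
i ==ᶠ j = ⌊ i ≟ j ⌋

record Graph (n : ℕ) : Set where
  field
    adj     : Fin n → Fin n → Bool
    adj-sym : ∀ u v → T (adj u v) → T (adj v u)
    irrefl  : ∀ u → adj u u ≡ false
    colour  : Fin n → ℕ
open Graph public

_⊇_ : {n : ℕ} → Graph n → Graph n → Set
G ⊇ F = (∀ u → colour G u ≡ colour F u) × (∀ u v → T (adj F u v) → T (adj G u v))

record Tree (n : ℕ) : Set where
  field
    leq     : Fin n → Fin n → Bool
    refl≼   : ∀ u → T (leq u u)
    antisym : ∀ u v → T (leq u v) → T (leq v u) → u ≡ v
    trans≼  : ∀ u v w → T (leq u v) → T (leq v w) → T (leq u w)
    uniqueMinimal :
      Σ (Fin n) λ r → (∀ u → T (leq u r) → u ≡ r)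
                    × (∀ s → (∀ u → T (leq u s) → u ≡ s) → s ≡ r)
    downChain : ∀ t u v → T (leq u t) → T (leq v t) → T (leq u v) ⊎ T (leq v u)
open Tree public

lt : {n : ℕ} → Tree n → Fin n → Fin n → Bool
lt T' u v = leq T' u v ∧ not (u ==ᶠ v)

IsChain : {n : ℕ} → Tree n → List (Fin n) → Set
IsChain T' c = Unique c × (∀ u v → u ∈ c → v ∈ c → T (leq T' u v) ⊎ T (leq T' v u))

HeightAtMost : {n : ℕ} → Tree n → ℕ → Set
HeightAtMost T' k = ∀ c → IsChain T' c → length c ≤ k

IsElimTree : {n : ℕ} → Graph n → Tree n → Set
IsElimTree F T' = ∀ u v → T (adj F u v) → T (leq T' u v) ⊎ T (leq T' v u)

InD : {n : ℕ} → ℕ → Graph n → Tree n → Set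
InD k F T' = IsElimTree F T' × HeightAtMost T' k

isHom : {n m : ℕ} → Graph n → Graph m → (Fin n → Fin m) → Bool
isHom F H h = allFinᵇ λ u → (colour F u ≡ᵇ colour H (h u))
                 ∧ allFinᵇ λ v → not (adj F u v) ∨ adj H (h u) (h v)

isPastInjective : {n m : ℕ} → Graph n → Tree n → Graph m → (Fin n → Fin m) → Bool
isPastInjective F T' H h =
  isHom F H h ∧ allFinᵇ λ u → allFinᵇ λ v → not (lt T' u v) ∨ not (h u ==ᶠ h v)

isPastPreserving : {n m : ℕ} → Graph n → Tree n → Graph m → (Fin n → Fin m) → Bool
isPastPreserving F T' H h =
  isPastInjective F T' H h ∧
  allFinᵇ λ u → allFinᵇ λ v → not (leq T' u v) ∨ (adj F u v ⇔ᵇ adj H (h u) (h v))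

funs : (n m : ℕ) → List (Fin n → Fin m)
funs zero m = (λ ()) ∷ []
funs (suc n) m = concatMap (λ f → map (λ i → ext i f) (allFin m)) (funs n m)
  where
  ext : Fin m → (Fin n → Fin m) → Fin (suc n) → Fin m
  ext i f zero = i
  ext i f (suc j) = f j

countMaps : (n m : ℕ) → ((Fin n → Fin m) → Bool) → ℕ
countMaps n m p = length (filterᵇ p (funs n m))

pi-hom : {n m : ℕ} → Graph n → Tree n → Graph m → ℕ
pi-hom {n} {m} F T' H = countMaps n m (isPastInjective F T' H)

pp-hom : {n m : ℕ} → Graph n → Tree n → Graph m → ℕ
pp-hom {n} {m} F T' H = countMaps n m (isPastPreserving F T' H)

module Submission where

-- For a set s of "slots" (pairs u ≺ v that are not edges of F) let F_s be F with the
-- slots in s added as edges; then F_s ⊇ F and (F_s , T) ∈ 𝒟_k.  A past-injective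
-- homomorphism h : F → H is past-preserving on F_s for exactly one s, namely the set of
-- slots that h maps onto edges of H.  Hence pi-hom(F, H) = Σ_s pp-hom(F_s, H), and the
-- hypothesis equates the two sums term by term.

open import Defs
open import Data.Bool using (Bool; true; false; not; _∧_; _∨_; T)
open import Data.Bool.Properties using (T-∧; T-∨; T-≡; T-not-≡; ∧-zeroʳ; ∨-identityʳ)
open import Data.Empty using (⊥-elim)
open import Data.Fin as Fin using (Fin; zero; suc)
open import Data.Fin.Properties using (_≟_)
open import Data.List using (List; []; _∷_; length; map; concatMap; allFin; filterᵇ; foldr; tabulate; _++_)
open import Data.List.Properties using (map-tabulate; foldr-map)
open import Data.Nat using (ℕ; zero; suc; _+_; _*_)
open import Data.Nat.Properties using (+-identityʳ; *-identityʳ; +-assoc; ≡ᵇ⇒≡; ≡⇒≡ᵇ; +-commutativeSemigroup)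
open import Algebra.Properties.CommutativeSemigroup +-commutativeSemigroup using () renaming (interchange to +-interchange)
open import Data.Product using (_×_; _,_; proj₁; proj₂)
open import Data.Sum using (_⊎_; inj₁; inj₂)
open import Function using (_∘_; id)
open import Function.Bundles using (_⇔_; mk⇔; module Equivalence)
open import Relation.Nullary using (¬_; yes; no)
open import Relation.Binary.PropositionalEquality

open Equivalence using (to; from)

T-injective : ∀ {a b} → (T a → T b) → (T b → T a) → a ≡ b
T-injective {false} {false} _ _ = refl
T-injective {false} {true}  _ f = ⊥-elim (f _)
T-injective {true}  {false} f _ = ⊥-elim (f _)
T-injective {true}  {true}  _ _ = refl

¬T⇒≡false : ∀ {a} → ¬ T a → a ≡ false
¬T⇒≡false {false} _ = refl
¬T⇒≡false {true}  f = ⊥-elim (f _)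

T-not-∨ : ∀ {a b} → T (not a ∨ b) ⇔ (T a → T b)
T-not-∨ {false} = mk⇔ (λ _ ()) _
T-not-∨ {true}  = mk⇔ (λ t _ → t) (λ f → f _)

T-⇔ᵇ : ∀ {a b} → T (a ⇔ᵇ b) ⇔ (a ≡ b)
T-⇔ᵇ {false} {false} = mk⇔ (λ _ → refl) _
T-⇔ᵇ {false} {true}  = mk⇔ (λ ()) (λ ())
T-⇔ᵇ {true}  {false} = mk⇔ (λ ()) (λ ())
T-⇔ᵇ {true}  {true}  = mk⇔ (λ _ → refl) _

==ᶠ-refl : ∀ {n} (u : Fin n) → u ==ᶠ u ≡ true
==ᶠ-refl u with u ≟ u
... | yes _ = refl
... | no u≢u = ⊥-elim (u≢u refl)

allFinᵇ-suc : ∀ {n} (p : Fin (suc n) → Bool) → allFinᵇ p ≡ p zero ∧ allFinᵇ (p ∘ suc)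
allFinᵇ-suc {n} p = cong (p zero ∧_) (begin
  foldr (λ i b → p i ∧ b) true (tabulate suc)
    ≡⟨ cong (foldr (λ i b → p i ∧ b) true) (map-tabulate {n = n} id Fin.suc) ⟨
  foldr (λ i b → p i ∧ b) true (map suc (allFin n))
    ≡⟨ foldr-map _ suc true (allFin n) ⟩
  foldr (λ i b → p (suc i) ∧ b) true (allFin n)
    ∎)
  where open ≡-Reasoning

T-allFinᵇ : ∀ {n} {p : Fin n → Bool} → T (allFinᵇ p) ⇔ (∀ i → T (p i))
T-allFinᵇ {zero}          = mk⇔ (λ _ ()) _
T-allFinᵇ {suc n} {p} rewrite allFinᵇ-suc p = mk⇔ split join
  where
  split : T (p zero ∧ allFinᵇ (p ∘ suc)) → ∀ i → T (p i)
  split t zero    = proj₁ (to T-∧ t)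
  split t (suc i) = to T-allFinᵇ (proj₂ (to T-∧ t)) i
  join : (∀ i → T (p i)) → T (p zero ∧ allFinᵇ (p ∘ suc))
  join f = from T-∧ (f zero , from T-allFinᵇ (f ∘ suc))

𝟙 : Bool → ℕ
𝟙 true  = 1
𝟙 false = 0

∑ : {A : Set} → List A → (A → ℕ) → ℕ
∑ []       f = 0
∑ (x ∷ xs) f = f x + ∑ xs f

count : {A : Set} → (A → Bool) → List A → ℕ
count p xs = ∑ xs (𝟙 ∘ p)

length-filterᵇ : {A : Set} (p : A → Bool) (xs : List A) → length (filterᵇ p xs) ≡ count p xs
length-filterᵇ p []       = refl
length-filterᵇ p (x ∷ xs) with p x
... | true  = cong suc (length-filterᵇ p xs)
... | false = length-filterᵇ p xs

module _ {A : Set} where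

  ∑-cong : ∀ {f g : A → ℕ} → (∀ x → f x ≡ g x) → ∀ xs → ∑ xs f ≡ ∑ xs g
  ∑-cong f≗g []       = refl
  ∑-cong f≗g (x ∷ xs) = cong₂ _+_ (f≗g x) (∑-cong f≗g xs)

  ∑-zero : ∀ xs → ∑ xs (λ (_ : A) → 0) ≡ 0
  ∑-zero []       = refl
  ∑-zero (x ∷ xs) = ∑-zero xs

  ∑-+ : ∀ (f g : A → ℕ) xs → ∑ xs (λ x → f x + g x) ≡ ∑ xs f + ∑ xs g
  ∑-+ f g []       = refl
  ∑-+ f g (x ∷ xs) =
    trans (cong (f x + g x +_) (∑-+ f g xs)) (+-interchange (f x) (g x) (∑ xs f) (∑ xs g))

  ∑-++ : ∀ (f : A → ℕ) xs ys → ∑ (xs ++ ys) f ≡ ∑ xs f + ∑ ys f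
  ∑-++ f []       ys = refl
  ∑-++ f (x ∷ xs) ys = trans (cong (f x +_) (∑-++ f xs ys)) (sym (+-assoc (f x) _ _))

  count-const-∧ : ∀ b (p : A → Bool) xs → count (λ x → b ∧ p x) xs ≡ 𝟙 b * count p xs
  count-const-∧ true  p xs = sym (+-identityʳ _)
  count-const-∧ false p xs = ∑-zero xs

module _ {A B : Set} where

  ∑-swap : ∀ (f : A → B → ℕ) xs ys → ∑ xs (λ x → ∑ ys (f x)) ≡ ∑ ys (λ y → ∑ xs (λ x → f x y))
  ∑-swap f []       ys = sym (∑-zero ys)
  ∑-swap f (x ∷ xs) ys = begin
    ∑ ys (f x) + ∑ xs (λ x → ∑ ys (f x))             ≡⟨ cong (∑ ys (f x) +_) (∑-swap f xs ys) ⟩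
    ∑ ys (f x) + ∑ ys (λ y → ∑ xs (λ x → f x y))     ≡⟨ ∑-+ (f x) _ ys ⟨
    ∑ ys (λ y → f x y + ∑ xs (λ x → f x y))          ∎
    where open ≡-Reasoning

  ∑-map : ∀ (f : B → ℕ) (g : A → B) xs → ∑ (map g xs) f ≡ ∑ xs (f ∘ g)
  ∑-map f g []       = refl
  ∑-map f g (x ∷ xs) = cong (f (g x) +_) (∑-map f g xs)

  ∑-concatMap : ∀ (f : B → ℕ) (g : A → List B) xs → ∑ (concatMap g xs) f ≡ ∑ xs (λ x → ∑ (g x) f)
  ∑-concatMap f g []       = refl
  ∑-concatMap f g (x ∷ xs) = trans (∑-++ f (g x) (concatMap g xs)) (cong (∑ (g x) f +_) (∑-concatMap f g xs))

record Enumerates {B : Set} (_≈ᵇ_ : B → B → Bool) (ys : List B) : Set where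
  constructor occurs-once
  field count-≈ : ∀ y → count (_≈ᵇ y) ys ≡ 1
open Enumerates

count-by-fibres : {A B : Set} {_≈ᵇ_ : B → B → Bool} {ys : List B} → Enumerates _≈ᵇ_ ys →
  (p : A → Bool) (f : A → B) (xs : List A) →
  count p xs ≡ ∑ ys (λ y → count (λ x → p x ∧ (y ≈ᵇ f x)) xs)
count-by-fibres {_≈ᵇ_ = _≈ᵇ_} {ys} enum p f xs = begin
  count p xs                                                  ≡⟨ ∑-cong (λ x → *-identityʳ (𝟙 (p x))) xs ⟨
  ∑ xs (λ x → 𝟙 (p x) * 1)                                    ≡⟨ ∑-cong (λ x → cong (𝟙 (p x) *_) (count-≈ enum (f x))) xs ⟨
  ∑ xs (λ x → 𝟙 (p x) * count (_≈ᵇ f x) ys)                   ≡⟨ ∑-cong (λ x → count-const-∧ (p x) (_≈ᵇ f x) ys) xs ⟨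
  ∑ xs (λ x → count (λ y → p x ∧ (y ≈ᵇ f x)) ys)              ≡⟨ ∑-swap (λ x y → 𝟙 (p x ∧ (y ≈ᵇ f x))) xs ys ⟩
  ∑ ys (λ y → count (λ x → p x ∧ (y ≈ᵇ f x)) xs)              ∎
  where open ≡-Reasoning

pointwise : {B : Set} {n : ℕ} → (B → B → Bool) → (Fin n → B) → (Fin n → B) → Bool
pointwise _≈ᵇ_ f g = allFinᵇ (λ i → f i ≈ᵇ g i)

_∷ᶠ_ : {B : Set} {n : ℕ} → B → (Fin n → B) → Fin (suc n) → B
(b ∷ᶠ f) zero    = b
(b ∷ᶠ f) (suc i) = f i

functions : {B : Set} → List B → (n : ℕ) → List (Fin n → B)
functions ys zero    = (λ ()) ∷ []
functions ys (suc n) = concatMap (λ b → map (b ∷ᶠ_) (functions ys n)) ys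

functions-enumerates : {B : Set} {_≈ᵇ_ : B → B → Bool} {ys : List B} → Enumerates _≈ᵇ_ ys →
  ∀ n → Enumerates (pointwise _≈ᵇ_) (functions ys n)
functions-enumerates enum zero    = occurs-once λ _ → refl
functions-enumerates {_≈ᵇ_ = _≈ᵇ_} {ys} enum (suc n) = occurs-once λ g → begin
  count (λ f → pointwise _≈ᵇ_ f g) (concatMap (λ b → map (b ∷ᶠ_) fs) ys)
    ≡⟨ ∑-concatMap _ (λ b → map (b ∷ᶠ_) fs) ys ⟩
  ∑ ys (λ b → ∑ (map (b ∷ᶠ_) fs) (λ f → 𝟙 (pointwise _≈ᵇ_ f g)))
    ≡⟨ ∑-cong (λ b → ∑-map _ (b ∷ᶠ_) fs) ys ⟩
  ∑ ys (λ b → count (λ f → pointwise _≈ᵇ_ (b ∷ᶠ f) g) fs)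
    ≡⟨ ∑-cong (λ b → ∑-cong (λ f → cong 𝟙 (allFinᵇ-suc (λ i → (b ∷ᶠ f) i ≈ᵇ g i))) fs) ys ⟩
  ∑ ys (λ b → count (λ f → (b ≈ᵇ g zero) ∧ pointwise _≈ᵇ_ f (g ∘ suc)) fs)
    ≡⟨ ∑-cong (λ b → count-const-∧ (b ≈ᵇ g zero) _ fs) ys ⟩
  ∑ ys (λ b → 𝟙 (b ≈ᵇ g zero) * count (λ f → pointwise _≈ᵇ_ f (g ∘ suc)) fs)
    ≡⟨ ∑-cong (λ b → cong (𝟙 (b ≈ᵇ g zero) *_) (count-≈ (functions-enumerates enum n) (g ∘ suc))) ys ⟩
  ∑ ys (λ b → 𝟙 (b ≈ᵇ g zero) * 1)
    ≡⟨ ∑-cong (λ b → *-identityʳ (𝟙 (b ≈ᵇ g zero))) ys ⟩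
  count (_≈ᵇ g zero) ys
    ≡⟨ count-≈ enum (g zero) ⟩
  1 ∎
  where
  open ≡-Reasoning
  fs = functions ys n

BoolRel : ℕ → Set
BoolRel n = Fin n → Fin n → Bool

_≈ʳ_ : {n : ℕ} → BoolRel n → BoolRel n → Bool
_≈ʳ_ = pointwise (pointwise _⇔ᵇ_)

relations : (n : ℕ) → List (BoolRel n)
relations n = functions (functions (true ∷ false ∷ []) n) n

relations-enumerate : ∀ n → Enumerates _≈ʳ_ (relations n)
relations-enumerate n = functions-enumerates (functions-enumerates bools-enumerate n) n
  where
  bools-enumerate : Enumerates _⇔ᵇ_ (true ∷ false ∷ [])
  bools-enumerate = occurs-once λ { true → refl ; false → refl }

T-≈ʳ : ∀ {n} {r s : BoolRel n} → T (r ≈ʳ s) ⇔ (∀ u v → r u v ≡ s u v)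
T-≈ʳ = mk⇔ (λ t u v → to T-⇔ᵇ (to T-allFinᵇ (to T-allFinᵇ t u) v))
           (λ r≗s → from T-allFinᵇ λ u → from T-allFinᵇ λ v → from T-⇔ᵇ (r≗s u v))

module _ {n : ℕ} (Tr : Tree n) where

  ≺⇒≼ : ∀ {u v} → T (lt Tr u v) → T (leq Tr u v)
  ≺⇒≼ u≺v = proj₁ (to T-∧ u≺v)

  ≺-irrefl : ∀ u → lt Tr u u ≡ false
  ≺-irrefl u rewrite ==ᶠ-refl u = ∧-zeroʳ (leq Tr u u)

  ≺-asym : ∀ {u v} → T (lt Tr u v) → lt Tr v u ≡ false
  ≺-asym {u} {v} u≺v = ¬T⇒≡false λ v≺u →
    let u≡v = antisym Tr u v (≺⇒≼ u≺v) (≺⇒≼ v≺u)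
    in subst T (≺-irrefl u) (subst (T ∘ lt Tr u) (sym u≡v) u≺v)

  ≼⇒≡⊎≺ : ∀ {u v} → T (leq Tr u v) → u ≡ v ⊎ T (lt Tr u v)
  ≼⇒≡⊎≺ {u} {v} u≼v with u ≟ v
  ... | yes u≡v = inj₁ u≡v
  ... | no  _   = inj₂ (from T-∧ (u≼v , _))

module _ {n m : ℕ} (G : Graph n) (H : Graph m) (h : Fin n → Fin m) where

  record IsHomomorphism : Set where
    field
      colour-preserving : ∀ u → colour G u ≡ colour H (h u)
      edge-preserving   : ∀ u v → T (adj G u v) → T (adj H (h u) (h v))

  T-isHom : T (isHom G H h) ⇔ IsHomomorphism
  T-isHom = mk⇔ reflect reify
    where
    reflect : T (isHom G H h) → IsHomomorphism
    reflect t = record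
      { colour-preserving = λ u → ≡ᵇ⇒≡ _ _ (proj₁ (row u))
      ; edge-preserving   = λ u v → to T-not-∨ (to T-allFinᵇ (proj₂ (row u)) v)
      }
      where row = λ u → to T-∧ (to T-allFinᵇ t u)
    reify : IsHomomorphism → T (isHom G H h)
    reify φ = from T-allFinᵇ λ u → from T-∧
      (≡⇒≡ᵇ _ _ (colour-preserving u) , from T-allFinᵇ λ v → from T-not-∨ (edge-preserving u v))
      where open IsHomomorphism φ

  module _ (Tr : Tree n) where

    PreservesPast : Set
    PreservesPast = ∀ u v → T (leq Tr u v) → adj G u v ≡ adj H (h u) (h v)

    preservesPastᵇ : Bool
    preservesPastᵇ = allFinᵇ λ u → allFinᵇ λ v → not (leq Tr u v) ∨ (adj G u v ⇔ᵇ adj H (h u) (h v))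

    T-preservesPast : T preservesPastᵇ ⇔ PreservesPast
    T-preservesPast = mk⇔
      (λ t u v u≼v → to T-⇔ᵇ (to T-not-∨ (to T-allFinᵇ (to T-allFinᵇ t u) v) u≼v))
      (λ π → from T-allFinᵇ λ u → from T-allFinᵇ λ v → from T-not-∨ λ u≼v → from T-⇔ᵇ (π u v u≼v))

isHom-⊇ : ∀ {n m} {G F : Graph n} {H : Graph m} {h} → G ⊇ F → IsHomomorphism G H h → IsHomomorphism F H h
isHom-⊇ (same-colour , F⊆G) φ = record
  { colour-preserving = λ u → trans (sym (same-colour u)) (colour-preserving u)
  ; edge-preserving   = λ u v uv → edge-preserving u v (F⊆G u v uv)
  }
  where open IsHomomorphism φ

module Completion {n : ℕ} (F : Graph n) (Tr : Tree n) where

  slot : BoolRel n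
  slot u v = lt Tr u v ∧ not (adj F u v)

  Supported : BoolRel n → Set
  Supported s = ∀ u v → T (s u v) → T (slot u v)

  supportedᵇ : BoolRel n → Bool
  supportedᵇ s = allFinᵇ λ u → allFinᵇ λ v → not (s u v) ∨ slot u v

  T-supported : ∀ {s} → T (supportedᵇ s) ⇔ Supported s
  T-supported = mk⇔ (λ t u v → to T-not-∨ (to T-allFinᵇ (to T-allFinᵇ t u) v))
                    (λ σ → from T-allFinᵇ λ u → from T-allFinᵇ λ v → from T-not-∨ (σ u v))

  module _ (s : BoolRel n) where

    extendAdj : BoolRel n
    extendAdj u v = adj F u v ∨ (lt Tr u v ∧ s u v) ∨ (lt Tr v u ∧ s v u)

    extendAdj-cases : ∀ {u v} → T (extendAdj u v) →
      T (adj F u v) ⊎ (T (lt Tr u v) × T (s u v)) ⊎ (T (lt Tr v u) × T (s v u))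
    extendAdj-cases {u} {v} t with to T-∨ t
    ... | inj₁ uv = inj₁ uv
    ... | inj₂ t′ with to (T-∨ {lt Tr u v ∧ s u v}) t′
    ...   | inj₁ forward  = inj₂ (inj₁ (to T-∧ forward))
    ...   | inj₂ backward = inj₂ (inj₂ (to T-∧ backward))

    extendAdj-intro : ∀ {u v} →
      T (adj F u v) ⊎ (T (lt Tr u v) × T (s u v)) ⊎ (T (lt Tr v u) × T (s v u)) → T (extendAdj u v)
    extendAdj-intro {u} {v} (inj₁ uv)        = from (T-∨ {adj F u v}) (inj₁ uv)
    extendAdj-intro {u} {v} (inj₂ (inj₁ fw)) =
      from (T-∨ {adj F u v}) (inj₂ (from (T-∨ {lt Tr u v ∧ s u v}) (inj₁ (from T-∧ fw))))
    extendAdj-intro {u} {v} (inj₂ (inj₂ bw)) =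
      from (T-∨ {adj F u v}) (inj₂ (from (T-∨ {lt Tr u v ∧ s u v}) (inj₂ (from T-∧ bw))))

    extendAdj-sym : ∀ u v → T (extendAdj u v) → T (extendAdj v u)
    extendAdj-sym u v t with extendAdj-cases t
    ... | inj₁ uv        = extendAdj-intro (inj₁ (adj-sym F u v uv))
    ... | inj₂ (inj₁ fw) = extendAdj-intro (inj₂ (inj₂ fw))
    ... | inj₂ (inj₂ bw) = extendAdj-intro (inj₂ (inj₁ bw))

    extendAdj-irrefl : ∀ u → extendAdj u u ≡ false
    extendAdj-irrefl u rewrite irrefl F u | ≺-irrefl Tr u = refl

    extend : Graph n
    extend = record
      { adj = extendAdj ; adj-sym = extendAdj-sym ; irrefl = extendAdj-irrefl ; colour = colour F }

    extend-⊇ : extend ⊇ F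
    extend-⊇ = (λ _ → refl) , λ u v uv → extendAdj-intro (inj₁ uv)

    extend-InD : ∀ {k} → InD k F Tr → InD k extend Tr
    extend-InD (elim , height) = elim′ , height
      where
      elim′ : IsElimTree extend Tr
      elim′ u v t with extendAdj-cases t
      ... | inj₁ uv               = elim u v uv
      ... | inj₂ (inj₁ (u≺v , _)) = inj₁ (≺⇒≼ Tr u≺v)
      ... | inj₂ (inj₂ (v≺u , _)) = inj₂ (≺⇒≼ Tr v≺u)

    extendAdj-≺ : ∀ {u v} → T (lt Tr u v) → extendAdj u v ≡ adj F u v ∨ s u v
    extendAdj-≺ {u} {v} u≺v rewrite ≺-asym Tr u≺v | to T-≡ u≺v = cong (adj F u v ∨_) (∨-identityʳ (s u v))

  module _ {m : ℕ} (H : Graph m) where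

    profile : (Fin n → Fin m) → BoolRel n
    profile h u v = slot u v ∧ adj H (h u) (h v)

    profile-supported : ∀ h → Supported (profile h)
    profile-supported h u v t = proj₁ (to T-∧ t)

    profile-≺ : ∀ h {u v} → T (lt Tr u v) → adj F u v ≡ false → profile h u v ≡ adj H (h u) (h v)
    profile-≺ h u≺v uv≡false rewrite to T-≡ u≺v | uv≡false = refl

    module _ {s : BoolRel n} {h : Fin n → Fin m} where

      ≗profile⇒preservesPast : IsHomomorphism F H h → (∀ u v → s u v ≡ profile h u v) →
        PreservesPast (extend s) H h Tr
      ≗profile⇒preservesPast φ s≗ u v u≼v with ≼⇒≡⊎≺ Tr u≼v
      ... | inj₁ refl = trans (extendAdj-irrefl s u) (sym (irrefl H (h u)))
      ... | inj₂ u≺v  = trans (extendAdj-≺ s u≺v) (by-F-edge (adj F u v) refl)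
        where
        by-F-edge : ∀ b → adj F u v ≡ b → b ∨ s u v ≡ adj H (h u) (h v)
        by-F-edge true  uv = sym (to T-≡ (IsHomomorphism.edge-preserving φ u v (from T-≡ uv)))
        by-F-edge false uv = trans (s≗ u v) (profile-≺ h u≺v uv)

      preservesPast⇒≗profile : Supported s → PreservesPast (extend s) H h Tr → ∀ u v → s u v ≡ profile h u v
      preservesPast⇒≗profile σ π u v with slot u v in slot≡
      ... | false = ¬T⇒≡false λ t → subst T slot≡ (σ u v t)
      ... | true  = begin
        s u v                        ≡⟨ cong (_∨ s u v) uv≡false ⟨
        adj F u v ∨ s u v            ≡⟨ extendAdj-≺ s u≺v ⟨
        extendAdj s u v              ≡⟨ π u v (≺⇒≼ Tr u≺v) ⟩
        adj H (h u) (h v)            ∎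
        where
        open ≡-Reasoning
        u≺v∧uv∉F = to T-∧ (from T-≡ slot≡)
        u≺v = proj₁ u≺v∧uv∉F
        uv≡false = to T-not-≡ (proj₂ u≺v∧uv∉F)

      isHom-extend : IsHomomorphism F H h → PreservesPast (extend s) H h Tr → IsHomomorphism (extend s) H h
      isHom-extend φ π = record { colour-preserving = colour-preserving ; edge-preserving = edge }
        where
        open IsHomomorphism φ
        edge : ∀ u v → T (extendAdj s u v) → T (adj H (h u) (h v))
        edge u v t with extendAdj-cases s t
        ... | inj₁ uv               = edge-preserving u v uv
        ... | inj₂ (inj₁ (u≺v , _)) = subst T (π u v (≺⇒≼ Tr u≺v)) t
        ... | inj₂ (inj₂ (v≺u , _)) = adj-sym H _ _ (subst T (π v u (≺⇒≼ Tr v≺u)) (extendAdj-sym s u v t))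

    profile-fibre : ∀ s h →
      (isPastInjective F Tr H h ∧ (s ≈ʳ profile h)) ≡ (supportedᵇ s ∧ isPastPreserving (extend s) Tr H h)
    profile-fibre s h = T-injective into outof
      where
      into : T (isPastInjective F Tr H h ∧ (s ≈ʳ profile h)) →
             T (supportedᵇ s ∧ isPastPreserving (extend s) Tr H h)
      into t =
        let piᵇ , s≈ᵇ      = to T-∧ t
            homᵇ , injᵇ    = to T-∧ piᵇ
            φ              = to (T-isHom F H h) homᵇ
            s≗             = to T-≈ʳ s≈ᵇ
            π              = ≗profile⇒preservesPast φ s≗
            σ u v suv      = profile-supported h u v (subst T (s≗ u v) suv)
            homᵇ′          = from (T-isHom (extend s) H h) (isHom-extend φ π)
            πᵇ             = from (T-preservesPast (extend s) H h Tr) π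
        in from T-∧ (from T-supported σ , from T-∧ (from T-∧ (homᵇ′ , injᵇ) , πᵇ))
      outof : T (supportedᵇ s ∧ isPastPreserving (extend s) Tr H h) →
              T (isPastInjective F Tr H h ∧ (s ≈ʳ profile h))
      outof t =
        let σᵇ , ppᵇ       = to T-∧ t
            piᵇ , πᵇ       = to T-∧ ppᵇ
            homᵇ , injᵇ    = to T-∧ piᵇ
            φ              = isHom-⊇ (extend-⊇ s) (to (T-isHom (extend s) H h) homᵇ)
            s≗             = preservesPast⇒≗profile (to T-supported σᵇ) (to (T-preservesPast (extend s) H h Tr) πᵇ)
        in from T-∧ (from T-∧ (from (T-isHom F H h) φ , injᵇ) , from T-≈ʳ s≗)

    pi-hom-as-sum : pi-hom F Tr H ≡ ∑ (relations n) (λ s → 𝟙 (supportedᵇ s) * pp-hom (extend s) Tr H)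
    pi-hom-as-sum = begin
      pi-hom F Tr H
        ≡⟨ length-filterᵇ _ hs ⟩
      count (isPastInjective F Tr H) hs
        ≡⟨ count-by-fibres (relations-enumerate n) _ profile hs ⟩
      ∑ (relations n) (λ s → count (λ h → isPastInjective F Tr H h ∧ (s ≈ʳ profile h)) hs)
        ≡⟨ ∑-cong (λ s → ∑-cong (λ h → cong 𝟙 (profile-fibre s h)) hs) (relations n) ⟩
      ∑ (relations n) (λ s → count (λ h → supportedᵇ s ∧ isPastPreserving (extend s) Tr H h) hs)
        ≡⟨ ∑-cong (λ s → count-const-∧ (supportedᵇ s) _ hs) (relations n) ⟩
      ∑ (relations n) (λ s → 𝟙 (supportedᵇ s) * count (isPastPreserving (extend s) Tr H) hs)
        ≡⟨ ∑-cong (λ s → cong (𝟙 (supportedᵇ s) *_) (length-filterᵇ _ hs)) (relations n) ⟨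
      ∑ (relations n) (λ s → 𝟙 (supportedᵇ s) * pp-hom (extend s) Tr H)
        ∎
      where
      open ≡-Reasoning
      hs = funs n m

corollary13 : (k n : ℕ) (F : Graph n) (T : Tree n) → InD k F T →
    {m m' : ℕ} (H : Graph m) (H' : Graph m') →
    ((G : Graph n) → G ⊇ F → InD k G T → pp-hom G T H ≡ pp-hom G T H') →
    pi-hom F T H ≡ pi-hom F T H'
corollary13 k n F Tr D∈𝒟ₖ H H' pp-hom-agree = begin
  pi-hom F Tr H
    ≡⟨ pi-hom-as-sum H ⟩
  ∑ (relations n) (λ s → 𝟙 (supportedᵇ s) * pp-hom (extend s) Tr H)
    ≡⟨ ∑-cong (λ s → cong (𝟙 (supportedᵇ s) *_) (pp-hom-agree (extend s) (extend-⊇ s) (extend-InD s D∈𝒟ₖ))) (relations n) ⟩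
  ∑ (relations n) (λ s → 𝟙 (supportedᵇ s) * pp-hom (extend s) Tr H')
    ≡⟨ pi-hom-as-sum H' ⟨
  pi-hom F Tr H'
    ∎
  where
  open ≡-Reasoning
  open Completion F Tr
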